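{- Let $n > 1$ be a positive integer with prime factorization $n = \prod_{i=1}^{\ell} p_i^{a_i}$, where $p_1 < p_2 < \cdots < p_{\ell}$ are primes and each $a_i \geq 1$. Then $F_n = D_n$ if and only if \[ p_i - 1 = \prod_{j=1}^{i-1} p_j^{a_j} \quad \text{for all } 1 \leq i \leq \ell \] (where the empty product for $i=1$ equals $1$).
   Context: For a composite positive integer $m$, let $d(m)$ denote the largest divisor of $m$ strictly between $1$ and $m$. Define $f$ on integers $m > 1$ by $f(m) = m - 1$ if $m$ is prime and $f(m) = m - d(m)$ if $m$ is composite. Let $f^{(0)}(n) = n$ and $f^{(i)} = f \circ f^{(i-1)}$. For an integer $n>1$, iterating $f$ starting from $n$ eventually reaches $1$; let $F_n = \{n, f(n), f^{(2)}(n), \dots, 1\}$ be the set of values obtained until $1$ is reached. Let $D_n$ denote the set of all positive divisors of $n$. -}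

module Defs where

open import Data.Nat using (ℕ; zero; suc; _∸_; _*_; _<_)
open import Data.Nat.Divisibility using (_∣?_)
open import Data.Nat.Primality using (prime?)
open import Data.Bool using (if_then_else_)
open import Data.Fin using (Fin) renaming (zero to fzero; suc to fsuc)
open import Data.Product using (∃-syntax; _×_)
open import Relation.Binary.PropositionalEquality using (_≡_; _≢_)
open import Relation.Nullary.Decidable using (yes; no; ⌊_⌋)

greatestDivUpTo : ℕ → ℕ → ℕ
greatestDivUpTo m zero = 0
greatestDivUpTo m (suc zero) = 0
greatestDivUpTo m (suc (suc k)) =
  if ⌊ suc (suc k) ∣? m ⌋ then suc (suc k) else greatestDivUpTo m (suc k)

-- d(m): the largest divisor of m strictly between 1 and m (meaningful for composite m)
d : ℕ → ℕ
d m = greatestDivUpTo m (m ∸ 1)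

f : ℕ → ℕ
f m with prime? m
... | yes _ = m ∸ 1
... | no  _ = m ∸ d m

iter : ℕ → ℕ → ℕ
iter zero    n = n
iter (suc i) n = f (iter i n)

-- m ∈ F_n : m is one of n, f(n), f²(n), …, stopping at the first 1
_∈F_ : ℕ → ℕ → Set
m ∈F n = ∃[ i ] (iter i n ≡ m × (∀ j → j < i → iter j n ≢ 1))

∏ : ∀ {ℓ} → (Fin ℓ → ℕ) → ℕ
∏ {zero}  g = 1
∏ {suc ℓ} g = g fzero * ∏ (λ i → g (fsuc i))

∏< : ∀ {ℓ} → (Fin ℓ → ℕ) → Fin ℓ → ℕ
∏< g fzero    = 1
∏< g (fsuc i) = g fzero * ∏< (λ j → g (fsuc j)) i

-- Let c be the least prime factor of m > 1. Then d(m) = m/c, so f(m) = (c − 1)·m/c.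
--
-- Say f walks the divisors of N when f sends every divisor g > 1 of N to the largest
-- divisor of N below g; then the orbit of N is exactly D_N. If f walks the divisors of N
-- and q = N + 1 is prime, it also walks those of N·q^a: these are the q^b·e with e ∣ N,
-- ordered lexicographically by (b, e) because e < q, and f(q^b·e) = q^b·f(e),
-- f(q^(b+1)) = q^b·N. Starting from N = 1, the condition on the p_i therefore gives F_n = D_n.
--
-- Conversely, fix i, let p = p_i and write n = P·Q with P = ∏_{j<i} p_j^{a_j}. The prime
-- factors of P are below p and those of Q are at least p. If F_n = D_n, then p − 1 = f(p)
-- divides n and has only prime factors below p, so p − 1 ∣ P; likewise every f(x) with
-- x ∣ P divides P, so the orbit of P stays in D_P and misses p. As F_n is a chain through
-- both P and p, this forces P < p, and hence p − 1 = P.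

{-# OPTIONS --safe #-}
module Submission where

open import Defs
open import Data.Fin using (Fin) renaming (zero to fzero; suc to fsuc; _<_ to _<ᶠ_; _≤_ to _≤ᶠ_)
open import Data.Fin.Properties using (toℕ-injective)
open import Data.Nat
open import Data.Nat.Coprimality using (Coprime; coprime-divisor)
open import Data.Nat.Divisibility
open import Data.Nat.Induction using (<-wellFounded)
open import Data.Nat.Primality
  using (Prime; prime; prime?; prime⇒nonZero; prime⇒nonTrivial; prime⇒irreducible; euclidsLemma; ¬prime[1])
open import Data.Nat.Properties
open import Algebra.Properties.CommutativeSemigroup *-commutativeSemigroup using (x∙yz≈y∙xz)
open import Data.Product using (∃; ∃₂; _×_; _,_; proj₁; proj₂; map₂)
open import Data.Sum using (_⊎_; inj₁; inj₂)
open import Function using (_∘_; case_of_)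
open import Function.Bundles using (_⇔_; mk⇔; Equivalence)
open import Induction.WellFounded using (Acc; acc)
open import Relation.Binary.PropositionalEquality
open import Relation.Nullary using (¬_; yes; no; contradiction)

≢1⇒>1 : ∀ {n} → 0 < n → n ≢ 1 → 1 < n
≢1⇒>1 0<n n≢1 = ≤∧≢⇒< 0<n (≢-sym n≢1)

∸1≡⇒≡suc : ∀ {n m} → 0 < n → n ∸ 1 ≡ m → n ≡ suc m
∸1≡⇒≡suc {suc n} _ refl = refl

divisor>0 : ∀ {m n} → 0 < n → m ∣ n → 0 < m
divisor>0 0<n m∣n = n≢0⇒n>0 λ { refl → <-irrefl (sym (0∣⇒≡0 m∣n)) 0<n }

m∣m^n : ∀ {m n} → 0 < n → m ∣ m ^ n
m∣m^n {n = suc n} _ = m∣m*n _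

record LeastFactor (m c : ℕ) : Set where
  constructor leastFactor
  field
    1<c   : 1 < c
    c∣m   : c ∣ m
    least : ∀ {h} → 1 < h → h ∣ m → c ≤ h

leastFactor-exists : ∀ {m} → 1 < m → ∃ (LeastFactor m)
leastFactor-exists {m} 1<m = search 2 (m ∸ 2) ≤-refl (m+[n∸m]≡n 1<m) (λ 1<h _ → 1<h)
  where
  search : ∀ k fuel → 1 < k → k + fuel ≡ m → (∀ {h} → 1 < h → h ∣ m → k ≤ h) → ∃ (LeastFactor m)
  search k fuel 1<k _ below with k ∣? m
  ... | yes k∣m = k , leastFactor 1<k k∣m below
  search k zero 1<k k+0≡m below | no k∤m =
    contradiction (subst (k ∣_) (trans (sym (+-identityʳ k)) k+0≡m) ∣-refl) k∤m
  search k (suc fuel) 1<k k+fuel≡m below | no k∤m =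
    search (suc k) fuel (m<n⇒m<1+n 1<k) (trans (sym (+-suc k fuel)) k+fuel≡m)
      (λ 1<h h∣m → ≤∧≢⇒< (below 1<h h∣m) λ { refl → k∤m h∣m })

leastFactor-prime : ∀ {m c} → LeastFactor m c → Prime c
leastFactor-prime (leastFactor 1<c c∣m least) = prime {{n>1⇒nonTrivial 1<c}} λ where
  (hasNonTrivialDivisor {d} d<c d∣c) → <⇒≱ d<c (least (nonTrivial⇒n>1 d) (∣-trans d∣c c∣m))

leastFactorisation : ∀ {m} → 1 < m → ∃₂ λ c k → LeastFactor m c × m ≡ c * k × 0 < k
leastFactorisation {m} 1<m with leastFactor-exists 1<m
... | c , lf@(leastFactor _ (divides k m≡kc) _) = c , k , lf , trans m≡kc (*-comm k c) ,
      n≢0⇒n>0 λ { refl → contradiction (subst (1 <_) m≡kc 1<m) λ () }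

greatestDivUpTo-≤ : ∀ m B → greatestDivUpTo m B ≤ B
greatestDivUpTo-≤ m zero = z≤n
greatestDivUpTo-≤ m (suc zero) = z≤n
greatestDivUpTo-≤ m (suc (suc b)) with greatestDivUpTo-≤ m (suc b) | suc (suc b) ∣? m
... | _  | yes _ = ≤-refl
... | ih | no _  = m≤n⇒m≤1+n ih

greatestDivUpTo-∣ : ∀ m B → 1 < greatestDivUpTo m B → greatestDivUpTo m B ∣ m
greatestDivUpTo-∣ m zero ()
greatestDivUpTo-∣ m (suc zero) ()
greatestDivUpTo-∣ m (suc (suc b)) with greatestDivUpTo-∣ m (suc b) | suc (suc b) ∣? m
... | _  | yes B∣m = λ _ → B∣m
... | ih | no _    = ih

greatestDivUpTo-greatest : ∀ m B {k} → 1 < k → k ∣ m → k ≤ B → k ≤ greatestDivUpTo m B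
greatestDivUpTo-greatest m zero 1<k _ k≤0 = contradiction (<-≤-trans 1<k k≤0) λ ()
greatestDivUpTo-greatest m (suc zero) 1<k _ k≤1 = contradiction (<-≤-trans 1<k k≤1) λ { (s≤s ()) }
greatestDivUpTo-greatest m (suc (suc b)) 1<k k∣m k≤B
  with greatestDivUpTo-greatest m (suc b) 1<k k∣m | suc (suc b) ∣? m
... | _  | yes _   = k≤B
... | ih | no B∤m  = ih (s≤s⁻¹ (≤∧≢⇒< k≤B λ { refl → B∤m k∣m }))

cofactor>1 : ∀ {m h g} → m ≡ h * g → g < m → 1 < h
cofactor>1 {h = zero} refl ()
cofactor>1 {h = suc zero} {g} refl g<m = contradiction (subst (g <_) (+-identityʳ g) g<m) (<-irrefl refl)
cofactor>1 {h = suc (suc _)} _ _ = s≤s (s≤s z≤n)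

d-cofactor : ∀ {m c k} → LeastFactor m c → m ≡ c * k → 1 < k → d m ≡ k
d-cofactor {m} {c} {k} (leastFactor 1<c c∣m least) m≡ck 1<k = ≤-antisym d≤k k≤d
  where
  k<m : k < m
  k<m = subst (k <_) (trans (*-comm k c) (sym m≡ck)) (m<m*n k c {{>-nonZero (<-trans z<s 1<k)}} 1<c)
  k≤d : k ≤ d m
  k≤d = greatestDivUpTo-greatest m (m ∸ 1) 1<k (divides c m≡ck) (∸-monoˡ-≤ 1 k<m)
  d<m : d m < m
  d<m = ≤-<-trans (greatestDivUpTo-≤ m (m ∸ 1)) (∸-monoʳ-< z<s (≤-<-trans z≤n k<m))
  d≤k : d m ≤ k
  d≤k with greatestDivUpTo-∣ m (m ∸ 1) (<-≤-trans 1<k k≤d)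
  ... | divides h m≡hd = *-cancelˡ-≤ c {{>-nonZero (<-trans z<s 1<c)}} (begin
    c * d m  ≤⟨ *-monoˡ-≤ (d m) (least (cofactor>1 m≡hd d<m) (divides (d m) m≡dh)) ⟩
    h * d m  ≡⟨ sym m≡hd ⟩
    m        ≡⟨ m≡ck ⟩
    c * k    ∎)
    where
    open ≤-Reasoning
    m≡dh = trans m≡hd (*-comm h (d m))

f-leastFactor : ∀ {m c k} → LeastFactor m c → m ≡ c * k → 0 < k → f m ≡ (c ∸ 1) * k
f-leastFactor {m} {c} {k} lf m≡ck 0<k = begin
  f m            ≡⟨ f≡m∸k ⟩
  m ∸ k          ≡⟨ cong₂ _∸_ m≡ck (sym (*-identityˡ k)) ⟩
  c * k ∸ 1 * k  ≡⟨ *-distribʳ-∸ k c 1 ⟨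
  (c ∸ 1) * k    ∎
  where
  open ≡-Reasoning
  open LeastFactor lf
  f≡m∸k : f m ≡ m ∸ k
  f≡m∸k with prime? m
  ... | yes m-prime = cong (m ∸_) (sym k≡1)
    where
    c≡m : c ≡ m
    c≡m with prime⇒irreducible m-prime c∣m
    ... | inj₁ refl = contradiction 1<c (<-irrefl refl)
    ... | inj₂ c≡m  = c≡m
    k≡1 : k ≡ 1
    k≡1 = *-cancelˡ-≡ k 1 m {{>-nonZero (<-trans z<s (subst (1 <_) c≡m 1<c))}}
            (trans (sym (trans m≡ck (cong (_* k) c≡m))) (sym (*-identityʳ m)))
  ... | no ¬m-prime = cong (m ∸_) (d-cofactor lf m≡ck 1<k)
    where
    1<k : 1 < k
    1<k = ≤∧≢⇒< 0<k λ { refl →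
            ¬m-prime (subst Prime (sym (trans m≡ck (*-identityʳ c))) (leastFactor-prime lf)) }

f-bounds : ∀ {m} → 1 < m → 0 < f m × f m < m
f-bounds {m} 1<m with leastFactorisation 1<m
... | c , k , lf , m≡ck , 0<k = subst (λ x → 0 < x × x < m) (sym (f-leastFactor lf m≡ck 0<k))
      ( *-mono-≤ (m<n⇒0<n∸m 1<c) 0<k
      , subst ((c ∸ 1) * k <_) (sym m≡ck) (*-monoˡ-< k {{>-nonZero 0<k}} (∸-monoʳ-< z<s (<⇒≤ 1<c))))
  where open LeastFactor lf

f-prime : ∀ {p} → Prime p → f p ≡ p ∸ 1
f-prime {p} p-prime with prime? p
... | yes _      = refl
... | no ¬prime = contradiction p-prime ¬prime

iter-suc : ∀ i n → iter (suc i) n ≡ iter i (f n)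
iter-suc zero    n = refl
iter-suc (suc i) n = cong f (iter-suc i n)

∈F-refl : ∀ {n} → n ∈F n
∈F-refl = 0 , refl , λ _ ()

∈F-tail : ∀ {m n} → n ≢ 1 → m ∈F f n → m ∈F n
∈F-tail {n = n} n≢1 (i , fⁱfn≡m , ≢1) = suc i , trans (iter-suc i n) fⁱfn≡m , λ where
  zero    _         → n≢1
  (suc j) (s≤s j<i) → ≢1 j j<i ∘ trans (sym (iter-suc j n))

∈F-inv : ∀ {m n} → m ∈F n → m ≡ n ⊎ (n ≢ 1 × m ∈F f n)
∈F-inv (zero , n≡m , _) = inj₁ (sym n≡m)
∈F-inv {n = n} (suc i , fⁱ⁺¹n≡m , ≢1) =
  inj₂ (≢1 0 z<s , i , trans (sym (iter-suc i n)) fⁱ⁺¹n≡m ,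
        λ j j<i → ≢1 (suc j) (s≤s j<i) ∘ trans (iter-suc j n))

∈F-f : ∀ {m n} → m ∈F n → m ≢ 1 → f m ∈F n
∈F-f (i , fⁱn≡m , ≢1) m≢1 = suc i , cong f fⁱn≡m ,
  λ j j≤i → case m≤n⇒m<n∨m≡n (s≤s⁻¹ j≤i) of λ where
  (inj₁ j<i)  → ≢1 j j<i
  (inj₂ refl) → m≢1 ∘ trans (sym fⁱn≡m)

∈F⇒≤ : ∀ {m n} → 0 < n → m ∈F n → m ≤ n
∈F⇒≤ {n = n} 0<n = go n (<-wellFounded n) 0<n
  where
  go : ∀ n → Acc _<_ n → 0 < n → ∀ {m} → m ∈F n → m ≤ n
  go n (acc rs) 0<n m∈ with ∈F-inv m∈
  ... | inj₁ refl = ≤-refl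
  ... | inj₂ (n≢1 , m∈′) with f-bounds (≢1⇒>1 0<n n≢1)
  ...   | 0<fn , fn<n = ≤-trans (go (f n) (rs fn<n) 0<fn m∈′) (<⇒≤ fn<n)

∈F-chain : ∀ {n a b} → 0 < n → a ∈F n → b ∈F n → b < a → b ∈F a
∈F-chain {n} 0<n = go n (<-wellFounded n) 0<n
  where
  go : ∀ n → Acc _<_ n → 0 < n → ∀ {a b} → a ∈F n → b ∈F n → b < a → b ∈F a
  go n (acc rs) 0<n a∈ b∈ b<a with ∈F-inv a∈
  ... | inj₁ refl = b∈
  ... | inj₂ (n≢1 , a∈′) with f-bounds (≢1⇒>1 0<n n≢1) | ∈F-inv b∈
  ...   | 0<fn , fn<n | inj₁ refl = contradiction (≤-<-trans (∈F⇒≤ 0<fn a∈′) fn<n) (<⇒≱ b<a ∘ <⇒≤)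
  ...   | 0<fn , fn<n | inj₂ (_ , b∈′) = go (f n) (rs fn<n) 0<fn a∈′ b∈′ b<a

f-PredecessorIn : ℕ → ℕ → Set
f-PredecessorIn N g = f g ∣ N × (∀ {m} → m ∣ N → f g < m → m ≮ g)

WalksDivisors : ℕ → Set
WalksDivisors N = ∀ {g} → g ∣ N → 1 < g → f-PredecessorIn N g

walksDivisors⇒orbit : ∀ {M} → 0 < M → WalksDivisors M →
                      ∀ {g} → g ∣ M → ∀ {m} → m ∈F g ⇔ (m ∣ M × m ≤ g)
walksDivisors⇒orbit {M} 0<M walk {g} g∣M = go g (<-wellFounded g) g∣M
  where
  go : ∀ g → Acc _<_ g → g ∣ M → ∀ {m} → m ∈F g ⇔ (m ∣ M × m ≤ g)
  go g (acc rs) g∣M {m} with g ≟ 1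
  ... | yes refl = mk⇔ to from
    where
    to : m ∈F 1 → m ∣ M × m ≤ 1
    to m∈ with ∈F-inv m∈
    ... | inj₁ refl     = g∣M , ≤-refl
    ... | inj₂ (1≢1 , _) = contradiction refl 1≢1
    from : m ∣ M × m ≤ 1 → m ∈F 1
    from (m∣M , m≤1) rewrite ≤-antisym m≤1 (divisor>0 0<M m∣M) = ∈F-refl
  ... | no g≢1 = mk⇔ to from
    where
    1<g = ≢1⇒>1 (divisor>0 0<M g∣M) g≢1
    fg<g = proj₂ (f-bounds 1<g)
    orbit-fg = go (f g) (rs fg<g) (proj₁ (walk g∣M 1<g))
    to : m ∈F g → m ∣ M × m ≤ g
    to m∈ with ∈F-inv m∈
    ... | inj₁ refl      = g∣M , ≤-refl
    ... | inj₂ (_ , m∈′) = map₂ (λ m≤fg → ≤-trans m≤fg (<⇒≤ fg<g)) (Equivalence.to orbit-fg m∈′)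
    from : m ∣ M × m ≤ g → m ∈F g
    from (m∣M , m≤g) with m≤n⇒m<n∨m≡n m≤g
    ... | inj₂ refl = ∈F-refl
    ... | inj₁ m<g  = ∈F-tail g≢1 (Equivalence.from orbit-fg
                        (m∣M , ≮⇒≥ λ fg<m → proj₂ (walk g∣M 1<g) m∣M fg<m m<g))

walksDivisors⇒F≡D : ∀ {M} → 0 < M → WalksDivisors M → ∀ m → (m ∈F M) ⇔ (m ∣ M)
walksDivisors⇒F≡D 0<M walk m = mk⇔
  (proj₁ ∘ Equivalence.to orbit)
  (λ m∣M → Equivalence.from orbit (m∣M , ∣⇒≤ {{>-nonZero 0<M}} m∣M))
  where orbit = walksDivisors⇒orbit 0<M walk ∣-refl

¬∣⇒coprime : ∀ {q h} → Prime q → ¬ q ∣ h → Coprime h q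
¬∣⇒coprime q-prime q∤h (i∣h , i∣q) with prime⇒irreducible q-prime i∣q
... | inj₁ i≡1 = i≡1
... | inj₂ refl = contradiction i∣h q∤h

∣q^b*e⇒∣e : ∀ {q h} b e → Prime q → ¬ q ∣ h → h ∣ q ^ b * e → h ∣ e
∣q^b*e⇒∣e {h = h} zero e _ _ h∣ = subst (h ∣_) (*-identityˡ e) h∣
∣q^b*e⇒∣e {q} {h} (suc b) e q-prime q∤h h∣ =
  ∣q^b*e⇒∣e b e q-prime q∤h
    (coprime-divisor (¬∣⇒coprime q-prime q∤h) (subst (h ∣_) (*-assoc q (q ^ b) e) h∣))

divisor-^* : ∀ {q M g} a → Prime q → g ∣ q ^ a * M → ∃₂ λ b e → b ≤ a × e ∣ M × g ≡ q ^ b * e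
divisor-^* {M = M} {g} zero _ g∣ = 0 , g , z≤n , subst (g ∣_) (*-identityˡ M) g∣ , sym (*-identityˡ g)
divisor-^* {q} {M} {g} (suc a) q-prime g∣ with q ∣? g
... | no q∤g
  with divisor-^* a q-prime (coprime-divisor (¬∣⇒coprime q-prime q∤g) (subst (g ∣_) (*-assoc q (q ^ a) M) g∣))
...   | b , e , b≤a , e∣M , g≡ = b , e , m≤n⇒m≤1+n b≤a , e∣M , g≡
divisor-^* {q} {M} (suc a) q-prime g∣ | yes (divides g′ refl)
  with divisor-^* a q-prime (*-cancelˡ-∣ q {{prime⇒nonZero q-prime}}
         (subst₂ _∣_ (*-comm g′ q) (*-assoc q (q ^ a) M) g∣))
...   | b , e , b≤a , e∣M , g′≡ = suc b , e , s≤s b≤a , e∣M ,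
          trans (*-comm g′ q) (trans (cong (q *_) g′≡) (sym (*-assoc q (q ^ b) e)))

^*-∣ : ∀ {q a b x M} → b ≤ a → x ∣ M → q ^ b * x ∣ q ^ a * M
^*-∣ {q} {a} {b} b≤a x∣M = *-pres-∣ (divides (q ^ (a ∸ b)) q^a≡) x∣M
  where
  q^a≡ : q ^ a ≡ q ^ (a ∸ b) * q ^ b
  q^a≡ = trans (cong (q ^_) (sym (m+[n∸m]≡n b≤a))) (trans (^-distribˡ-+-* q b (a ∸ b)) (*-comm (q ^ b) _))

^*-< : ∀ {q c b x y} → c < b → x < q → 0 < y → q ^ c * x < q ^ b * y
^*-< {q} {c} {b} {x} {y} c<b x<q 0<y = begin-strict
  q ^ c * x  <⟨ *-monoʳ-< (q ^ c) {{m^n≢0 q c}} x<q ⟩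
  q ^ c * q  ≡⟨ *-comm (q ^ c) q ⟩
  q ^ suc c  ≤⟨ ^-monoʳ-≤ q c<b ⟩
  q ^ b      ≤⟨ m≤m*n (q ^ b) y {{>-nonZero 0<y}} ⟩
  q ^ b * y  ∎
  where
  open ≤-Reasoning
  instance _ = >-nonZero (≤-<-trans z≤n x<q)

^*-<⇒≤ : ∀ {q} c b {x y} → q ^ c * x < q ^ b * y → 0 < x → y < q → c ≤ b
^*-<⇒≤ c b lt 0<x y<q = ≮⇒≥ λ b<c → <-asym lt (^*-< b<c y<q 0<x)

least-^* : ∀ {q e c} b → Prime q → c ≤ q → (∀ {h} → 1 < h → h ∣ e → c ≤ h) →
           ∀ {h} → 1 < h → h ∣ q ^ b * e → c ≤ h
least-^* {q} {e} b q-prime c≤q least {h} 1<h h∣ with q ∣? h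
... | yes q∣h = ≤-trans c≤q (∣⇒≤ {{>-nonZero (<-trans z<s 1<h)}} q∣h)
... | no q∤h  = least 1<h (∣q^b*e⇒∣e b e q-prime q∤h h∣)

f-^* : ∀ {q e} b → Prime q → 1 < e → e < q → f (q ^ b * e) ≡ q ^ b * f e
f-^* {q} {e} b q-prime 1<e e<q with leastFactorisation 1<e
... | c , k , lf@(leastFactor 1<c c∣e least) , e≡ck , 0<k = begin
  f (q ^ b * e)          ≡⟨ f-leastFactor lf′ q^be≡ (*-mono-≤ (m^n>0 q b) 0<k) ⟩
  (c ∸ 1) * (q ^ b * k)  ≡⟨ x∙yz≈y∙xz (c ∸ 1) (q ^ b) k ⟩
  q ^ b * ((c ∸ 1) * k)  ≡⟨ cong (q ^ b *_) (f-leastFactor lf e≡ck 0<k) ⟨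
  q ^ b * f e            ∎
  where
  open ≡-Reasoning
  instance _ = prime⇒nonZero q-prime
  q^be≡ : q ^ b * e ≡ c * (q ^ b * k)
  q^be≡ = trans (cong (q ^ b *_) e≡ck) (x∙yz≈y∙xz (q ^ b) c k)
  lf′ : LeastFactor (q ^ b * e) c
  lf′ = leastFactor 1<c (∣n⇒∣m*n (q ^ b) c∣e)
          (least-^* b q-prime (≤-trans (∣⇒≤ {{>-nonZero (<-trans z<s 1<e)}} c∣e) (<⇒≤ e<q)) least)

f-prime^ : ∀ {q} b → Prime q → f (q ^ suc b) ≡ q ^ b * (q ∸ 1)
f-prime^ {q} b q-prime = trans (f-leastFactor lf refl (m^n>0 q b)) (*-comm (q ∸ 1) (q ^ b))
  where
  instance _ = prime⇒nonZero q-prime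
  lf : LeastFactor (q ^ suc b) q
  lf = leastFactor (nonTrivial⇒n>1 q {{prime⇒nonTrivial q-prime}}) (m∣m*n (q ^ b))
         λ {h} 1<h h∣ → least-^* (suc b) q-prime ≤-refl
                          (λ 1<h′ h′∣1 → contradiction (∣1⇒≡1 h′∣1) (>⇒≢ 1<h′))
                          1<h (subst (h ∣_) (sym (*-identityʳ (q ^ suc b))) h∣)

module AdjoinPrime {M} (0<M : 0 < M) (walk : WalksDivisors M) (q-prime : Prime (suc M)) where

  q : ℕ
  q = suc M

  divisor<q : ∀ {x} → x ∣ M → x < q
  divisor<q x∣M = s≤s (∣⇒≤ {{>-nonZero 0<M}} x∣M)

  exponent-≤ : ∀ c b {x y} → q ^ c * x < q ^ b * y → x ∣ M → y ∣ M → c ≤ b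
  exponent-≤ c b lt x∣M y∣M = ^*-<⇒≤ c b lt (divisor>0 0<M x∣M) (divisor<q y∣M)

  predecessor-q^b*e : ∀ {a b e} → b ≤ a → e ∣ M → 1 < e → f-PredecessorIn (q ^ a * M) (q ^ b * e)
  predecessor-q^b*e {a} {b} {e} b≤a e∣M 1<e = subst (_∣ q ^ a * M) (sym fg≡) (^*-∣ b≤a fe∣M) , gap
    where
    fg≡ : f (q ^ b * e) ≡ q ^ b * f e
    fg≡ = f-^* b q-prime 1<e (divisor<q e∣M)
    fe∣M = proj₁ (walk e∣M 1<e)
    gap : ∀ {m} → m ∣ q ^ a * M → f (q ^ b * e) < m → m ≮ q ^ b * e
    gap m∣ fg<m m<g with divisor-^* a q-prime m∣
    ... | c , x , _ , x∣M , refl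
      with subst (_< q ^ c * x) fg≡ fg<m
    ... | q^bfe<m with ≤-antisym (exponent-≤ c b m<g x∣M e∣M) (exponent-≤ b c q^bfe<m fe∣M x∣M)
    ... | refl = proj₂ (walk e∣M 1<e) x∣M (*-cancelˡ-< (q ^ c) _ _ q^bfe<m) (*-cancelˡ-< (q ^ c) _ _ m<g)

  predecessor-q^b : ∀ {a b} → suc b ≤ a → f-PredecessorIn (q ^ a * M) (q ^ suc b)
  predecessor-q^b {a} {b} b<a = subst (_∣ q ^ a * M) (sym fg≡) (^*-∣ (<⇒≤ b<a) ∣-refl) , gap
    where
    fg≡ : f (q ^ suc b) ≡ q ^ b * M
    fg≡ = f-prime^ b q-prime
    gap : ∀ {m} → m ∣ q ^ a * M → f (q ^ suc b) < m → m ≮ q ^ suc b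
    gap m∣ fg<m m<g with divisor-^* a q-prime m∣
    ... | c , x , _ , x∣M , refl
      with subst (_< q ^ c * x) fg≡ fg<m | subst (q ^ c * x <_) (sym (*-identityʳ (q ^ suc b))) m<g
    ... | q^bM<m | m<q^b⁺¹*1 with m≤n⇒m<n∨m≡n (exponent-≤ c (suc b) m<q^b⁺¹*1 x∣M (1∣ M))
    ... | inj₂ refl = <⇒≱ (*-cancelˡ-< (q ^ c) x 1 m<q^b⁺¹*1) (divisor>0 0<M x∣M)
    ... | inj₁ c<b⁺¹ with ≤-antisym (s≤s⁻¹ c<b⁺¹) (exponent-≤ b c q^bM<m ∣-refl x∣M)
    ...   | refl = <⇒≱ (*-cancelˡ-< (q ^ c) M x q^bM<m) (∣⇒≤ {{>-nonZero 0<M}} x∣M)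

  walksDivisors-^* : ∀ a → WalksDivisors (q ^ a * M)
  walksDivisors-^* a g∣ 1<g with divisor-^* a q-prime g∣
  ... | b , e , b≤a , e∣M , refl with e ≟ 1
  ... | no e≢1 = predecessor-q^b*e b≤a e∣M (≢1⇒>1 (divisor>0 0<M e∣M) e≢1)
  ... | yes refl with b
  ...   | zero   = contradiction 1<g (<-irrefl refl)
  ...   | suc b′ = subst (f-PredecessorIn (q ^ a * M)) (sym (*-identityʳ (q ^ suc b′))) (predecessor-q^b b≤a)

walksDivisors-1 : WalksDivisors 1
walksDivisors-1 g∣1 1<g = contradiction (∣1⇒≡1 g∣1) (>⇒≢ 1<g)

walksDivisors-∏ : ∀ {ℓ M} (p a : Fin ℓ → ℕ) → 0 < M → WalksDivisors M → (∀ i → Prime (p i)) →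
                  (∀ i → p i ∸ 1 ≡ M * ∏< (λ j → p j ^ a j) i) →
                  WalksDivisors (M * ∏ (λ i → p i ^ a i))
walksDivisors-∏ {zero} {M} p a 0<M walk _ _ = subst WalksDivisors (sym (*-identityʳ M)) walk
walksDivisors-∏ {suc ℓ} {M} p a 0<M walk p-prime pred-p≡ =
  subst WalksDivisors (*-assoc M (p₀ ^ a fzero) _)
    (walksDivisors-∏ (p ∘ fsuc) (a ∘ fsuc) 0<M′ walk′ (p-prime ∘ fsuc)
      λ i → trans (pred-p≡ (fsuc i)) (sym (*-assoc M (p₀ ^ a fzero) _)))
  where
  p₀ = p fzero
  p₀≡ : p₀ ≡ suc M
  p₀≡ = ∸1≡⇒≡suc (<-trans z<s (nonTrivial⇒n>1 p₀ {{prime⇒nonTrivial (p-prime fzero)}}))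
          (trans (pred-p≡ fzero) (*-identityʳ M))
  walk′ : WalksDivisors (M * p₀ ^ a fzero)
  walk′ = subst WalksDivisors (trans (cong (λ q → q ^ a fzero * M) (sym p₀≡)) (*-comm _ M))
            (AdjoinPrime.walksDivisors-^* 0<M walk (subst Prime p₀≡ (p-prime fzero)) (a fzero))
  0<M′ : 0 < M * p₀ ^ a fzero
  0<M′ = *-mono-≤ 0<M (m^n>0 p₀ {{prime⇒nonZero (p-prime fzero)}} (a fzero))

AllPrimeFactors : (ℕ → Set) → ℕ → Set
AllPrimeFactors P x = ∀ {r} → Prime r → r ∣ x → P r

allPrimeFactors-∣ : ∀ {P x y} → y ∣ x → AllPrimeFactors P x → AllPrimeFactors P y
allPrimeFactors-∣ y∣x Px r-prime r∣y = Px r-prime (∣-trans r∣y y∣x)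

allPrimeFactors-1 : ∀ {P} → AllPrimeFactors P 1
allPrimeFactors-1 r-prime r∣1 = contradiction (subst Prime (∣1⇒≡1 r∣1) r-prime) ¬prime[1]

allPrimeFactors-* : ∀ {P x y} → AllPrimeFactors P x → AllPrimeFactors P y → AllPrimeFactors P (x * y)
allPrimeFactors-* {x = x} {y} Px Py r-prime r∣xy with euclidsLemma x y r-prime r∣xy
... | inj₁ r∣x = Px r-prime r∣x
... | inj₂ r∣y = Py r-prime r∣y

allPrimeFactors-^ : ∀ {P x} a → AllPrimeFactors P x → AllPrimeFactors P (x ^ a)
allPrimeFactors-^ {P} zero Px = allPrimeFactors-1 {P}
allPrimeFactors-^ (suc a)  Px = allPrimeFactors-* Px (allPrimeFactors-^ a Px)

allPrimeFactors-prime : ∀ {P q} → Prime q → P q → AllPrimeFactors P q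
allPrimeFactors-prime {P} q-prime Pq r-prime r∣q with prime⇒irreducible q-prime r∣q
... | inj₁ refl = contradiction r-prime ¬prime[1]
... | inj₂ refl = Pq

allPrimeFactors-< : ∀ {p x} → 0 < x → x < p → AllPrimeFactors (_< p) x
allPrimeFactors-< 0<x x-below r-prime r∣x = ≤-<-trans (∣⇒≤ {{>-nonZero 0<x}} r∣x) x-below

coprime-separated : ∀ {p x y} → 0 < x → AllPrimeFactors (_< p) x → AllPrimeFactors (p ≤_) y → Coprime x y
coprime-separated {x = x} 0<x x-below y-above {i} (i∣x , i∣y) with i ≟ 1
... | yes i≡1 = i≡1
... | no i≢1 with leastFactor-exists (≢1⇒>1 (divisor>0 0<x i∣x) i≢1)
...   | r , lf =
  contradiction (y-above r-prime (∣-trans r∣i i∣y)) (<⇒≱ (x-below r-prime (∣-trans r∣i i∣x)))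
  where
  r-prime = leastFactor-prime lf
  r∣i = LeastFactor.c∣m lf

∣-lowerPart : ∀ {n P Q p x} → n ≡ P * Q → AllPrimeFactors (p ≤_) Q →
              0 < x → AllPrimeFactors (_< p) x → x ∣ n → x ∣ P
∣-lowerPart {P = P} {Q} n≡PQ Q-above 0<x x-below x∣n =
  coprime-divisor (coprime-separated 0<x x-below Q-above) (subst (_ ∣_) (trans n≡PQ (*-comm P Q)) x∣n)

f-lowerPart : ∀ {p x} → 1 < x → AllPrimeFactors (_< p) x → AllPrimeFactors (_< p) (f x)
f-lowerPart {p} {x} 1<x x-below with leastFactorisation 1<x
... | c , k , lf@(leastFactor 1<c c∣x _) , x≡ck , 0<k =
  subst (AllPrimeFactors (_< p)) (sym (f-leastFactor lf x≡ck 0<k))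
    (allPrimeFactors-* (allPrimeFactors-< (m<n⇒0<n∸m 1<c) (<-trans (∸-monoʳ-< z<s (<⇒≤ 1<c)) c<p))
                       (allPrimeFactors-∣ (divides c x≡ck) x-below))
  where
  c<p : c < p
  c<p = x-below (leastFactor-prime lf) c∣x

orbit-lowerPart : ∀ {n P Q p} → n ≡ P * Q → 0 < P →
                  AllPrimeFactors (_< p) P → AllPrimeFactors (p ≤_) Q →
                  (∀ {m} → m ∈F n → m ∣ n) → ∀ {x} → x ∈F n → x ∣ P → ∀ {m} → m ∈F x → m ∣ P
orbit-lowerPart {n} {P} {Q} {p} n≡PQ 0<P P-below Q-above F⊆D {x} = go x (<-wellFounded x)
  where
  go : ∀ x → Acc _<_ x → x ∈F n → x ∣ P → ∀ {m} → m ∈F x → m ∣ P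
  go x (acc rs) x∈ x∣P m∈ with ∈F-inv m∈
  ... | inj₁ refl = x∣P
  ... | inj₂ (x≢1 , m∈′) = go (f x) (rs (proj₂ fx-bounds)) fx∈ fx∣P m∈′
    where
    1<x = ≢1⇒>1 (divisor>0 0<P x∣P) x≢1
    fx-bounds = f-bounds 1<x
    fx∈ = ∈F-f x∈ x≢1
    fx∣P = ∣-lowerPart n≡PQ Q-above (proj₁ fx-bounds)
             (f-lowerPart 1<x (allPrimeFactors-∣ x∣P P-below)) (F⊆D fx∈)

F≡D⇒pred≡lowerPart : ∀ {n P Q p} → 0 < n → n ≡ P * Q → Prime p → p ∣ Q →
                     AllPrimeFactors (_< p) P → AllPrimeFactors (p ≤_) Q →
                     (∀ m → (m ∈F n) ⇔ (m ∣ n)) → p ∸ 1 ≡ P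
F≡D⇒pred≡lowerPart {n} {P} {Q} {p} 0<n n≡PQ p-prime p∣Q P-below Q-above F≡D = ≤-antisym p-1≤P P≤p-1
  where
  D⊆F : ∀ {m} → m ∣ n → m ∈F n
  D⊆F = Equivalence.from (F≡D _)
  F⊆D : ∀ {m} → m ∈F n → m ∣ n
  F⊆D = Equivalence.to (F≡D _)
  1<p = nonTrivial⇒n>1 p {{prime⇒nonTrivial p-prime}}
  0<p-1 = m<n⇒0<n∸m 1<p
  p∤P : ¬ p ∣ P
  p∤P p∣P = <-irrefl refl (P-below p-prime p∣P)
  0<P : 0 < P
  0<P = n≢0⇒n>0 λ { refl → p∤P (divides 0 refl) }
  P∈ : P ∈F n
  P∈ = D⊆F (divides Q (trans n≡PQ (*-comm P Q)))
  p∈ : p ∈F n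
  p∈ = D⊆F (subst (p ∣_) (sym n≡PQ) (∣n⇒∣m*n P p∣Q))
  p-1∣P : p ∸ 1 ∣ P
  p-1∣P = ∣-lowerPart n≡PQ Q-above 0<p-1 (allPrimeFactors-< 0<p-1 (∸-monoʳ-< z<s (<⇒≤ 1<p)))
            (F⊆D (subst (_∈F n) (f-prime p-prime) (∈F-f p∈ (>⇒≢ 1<p))))
  p-1≤P : p ∸ 1 ≤ P
  p-1≤P = ∣⇒≤ {{>-nonZero 0<P}} p-1∣P
  -- otherwise p < P, and p would lie on the orbit of P
  P≤p-1 : P ≤ p ∸ 1
  P≤p-1 = ≮⇒≥ λ p-1<P → p∤P (orbit-lowerPart n≡PQ 0<P P-below Q-above F⊆D P∈ ∣-refl
            (∈F-chain 0<n P∈ p∈ (≤∧≢⇒< (subst (_≤ P) (sym (∸1≡⇒≡suc (<-trans z<s 1<p) refl)) p-1<P)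
                                         λ { refl → p∤P ∣-refl })))

∏≥ : ∀ {ℓ} → (Fin ℓ → ℕ) → Fin ℓ → ℕ
∏≥ g fzero    = ∏ g
∏≥ g (fsuc i) = ∏≥ (g ∘ fsuc) i

∏-split : ∀ {ℓ} (g : Fin ℓ → ℕ) i → ∏ g ≡ ∏< g i * ∏≥ g i
∏-split g fzero    = sym (+-identityʳ (∏ g))
∏-split g (fsuc i) = trans (cong (g fzero *_) (∏-split (g ∘ fsuc) i)) (sym (*-assoc (g fzero) _ _))

∣∏≥ : ∀ {ℓ} (g : Fin ℓ → ℕ) i → g i ∣ ∏≥ g i
∣∏≥ g fzero    = m∣m*n _
∣∏≥ g (fsuc i) = ∣∏≥ (g ∘ fsuc) i

allPrimeFactors-∏ : ∀ {P ℓ} (g : Fin ℓ → ℕ) → (∀ k → AllPrimeFactors P (g k)) →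
                    AllPrimeFactors P (∏ g)
allPrimeFactors-∏ {P} {zero}  g _  = allPrimeFactors-1 {P}
allPrimeFactors-∏ {ℓ = suc ℓ} g Pg = allPrimeFactors-* (Pg fzero) (allPrimeFactors-∏ (g ∘ fsuc) (Pg ∘ fsuc))

allPrimeFactors-∏< : ∀ {P ℓ} (g : Fin ℓ → ℕ) i → (∀ j → j <ᶠ i → AllPrimeFactors P (g j)) →
                     AllPrimeFactors P (∏< g i)
allPrimeFactors-∏< {P} g fzero    _  = allPrimeFactors-1 {P}
allPrimeFactors-∏<     g (fsuc i) Pg = allPrimeFactors-* (Pg fzero z<s)
                                         (allPrimeFactors-∏< (g ∘ fsuc) i λ j j<i → Pg (fsuc j) (s<s j<i))

allPrimeFactors-∏≥ : ∀ {P ℓ} (g : Fin ℓ → ℕ) i → (∀ k → i ≤ᶠ k → AllPrimeFactors P (g k)) →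
                     AllPrimeFactors P (∏≥ g i)
allPrimeFactors-∏≥ g fzero    Pg = allPrimeFactors-∏ g λ k → Pg k z≤n
allPrimeFactors-∏≥ g (fsuc i) Pg = allPrimeFactors-∏≥ (g ∘ fsuc) i λ k i≤k → Pg (fsuc k) (s≤s i≤k)

lemma2 : (n : ℕ) → 1 < n →
         (ℓ : ℕ) (p a : Fin ℓ → ℕ) →
         (∀ i → Prime (p i)) →
         (∀ i j → i <ᶠ j → p i < p j) →
         (∀ i → 1 ≤ a i) →
         n ≡ ∏ (λ i → p i ^ a i) →
         ((∀ m → (m ∈F n) ⇔ (m ∣ n)) ⇔ (∀ i → p i ∸ 1 ≡ ∏< (λ j → p j ^ a j) i))
lemma2 n 1<n ℓ p a p-prime p-mono 0<a n≡∏ = mk⇔ F≡D⇒pred≡ pred≡⇒F≡D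
  where
  G : Fin ℓ → ℕ
  G i = p i ^ a i
  0<n = <-trans z<s 1<n
  p-mono-≤ : ∀ {i k} → i ≤ᶠ k → p i ≤ p k
  p-mono-≤ {i} {k} i≤k with m≤n⇒m<n∨m≡n i≤k
  ... | inj₁ i<k = <⇒≤ (p-mono i k i<k)
  ... | inj₂ i≡k = ≤-reflexive (cong p (toℕ-injective i≡k))
  F≡D⇒pred≡ : (∀ m → (m ∈F n) ⇔ (m ∣ n)) → ∀ i → p i ∸ 1 ≡ ∏< G i
  F≡D⇒pred≡ F≡D i = F≡D⇒pred≡lowerPart 0<n (trans n≡∏ (∏-split G i)) (p-prime i)
    (∣-trans (m∣m^n (0<a i)) (∣∏≥ G i))
    (allPrimeFactors-∏< G i λ j j<i → allPrimeFactors-^ (a j) (allPrimeFactors-prime (p-prime j) (p-mono j i j<i)))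
    (allPrimeFactors-∏≥ G i λ k i≤k → allPrimeFactors-^ (a k) (allPrimeFactors-prime (p-prime k) (p-mono-≤ i≤k)))
    F≡D
  pred≡⇒F≡D : (∀ i → p i ∸ 1 ≡ ∏< G i) → ∀ m → (m ∈F n) ⇔ (m ∣ n)
  pred≡⇒F≡D pred≡ = walksDivisors⇒F≡D 0<n (subst WalksDivisors (trans (*-identityˡ (∏ G)) (sym n≡∏))
    (walksDivisors-∏ p a z<s walksDivisors-1 p-prime λ i → trans (pred≡ i) (sym (*-identityˡ (∏< G i)))))
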